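{- Let $\theta>0$ be a real number. For integers $N\ge 1$ and $r\ge 0$ define \[ W_N(r)=\sum_{\substack{\pi\in\mathfrak{S}_N\\ \pi \text{ is } r\text{ -winnable}}} \theta^{\pi^{ -1}(N)-1}. \] Then $W_1(0)=1$, $W_1(r)=0$ for all $r\ge 1$, and for all $N\ge 2$ and all integers $0\le r\le N-1$, \[ W_N(r)=(N-1)\,W_{N-1}(r)+r\,(N-2)!\,\theta^{N-1}. \]
   Context: $\mathfrak{S}_N$ is the set of permutations $\pi$ of $\{1,\dots,N\}$, written in one-line notation $\pi=[\pi_1\pi_2\cdots\pi_N]$; $\pi^{ -1}(N)$ is the position of the entry $N$. An entry $\pi_j$ is a left-to-right maximum if $\pi_j>\pi_i$ for all $i<j$. For an integer $r\ge 0$, the $r$-positional strategy rejects $\pi_1,\dots,\pi_r$ and then accepts the first left-to-right maximum occurring at a position greater than $r$ (if there is none, nothing is accepted). A permutation $\pi$ is $r$-winnable if the $r$-positional strategy accepts the entry $N$, i.e. the first left-to-right maximum of $\pi$ at a position $>r$ exists and equals $N$. (For $r\ge 1$ this means position $r$ lies between the last two left-to-right maxima of $\pi$; for $r=0$ it means $\pi_1=N$.) -}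

module Defs where

open import Data.Nat using (ℕ; zero; suc; _<ᵇ_; _≡ᵇ_; _⊔_)
open import Data.Bool using (Bool; true; false; if_then_else_; _∧_; not; _∨_)
open import Data.List using (List; []; _∷_; map; concatMap; filter; foldr; upTo)
open import Data.Bool.ListAction using (any)
open import Data.Maybe using (Maybe; just; nothing)
open import Data.Product using (_×_; _,_)
open import Algebra.Bundles using (CommutativeSemiring)
import Algebra.Definitions.RawSemiring as RS

-- Permutations of {1,…,N} in one-line notation are lists of naturals.

range1 : ℕ → List ℕ
range1 N = map suc (upTo N)

words : ℕ → ℕ → List (List ℕ)
words N zero    = [] ∷ []
words N (suc k) = concatMap (λ w → map (λ x → x ∷ w) (range1 N)) (words N k)

elemᵇ : ℕ → List ℕ → Bool
elemᵇ x xs = any (λ y → x ≡ᵇ y) xs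

distinctᵇ : List ℕ → Bool
distinctᵇ []       = true
distinctᵇ (x ∷ xs) = not (elemᵇ x xs) ∧ distinctᵇ xs

-- 𝔖_N : words of length N over {1..N} with pairwise distinct entries
-- (exactly the permutations of {1..N} in one-line notation, each once)
perms : ℕ → List (List ℕ)
perms N = filter (λ w → distinctᵇ w Data.Bool.≟ true) (words N N)
  where import Data.Bool

-- The r-positional strategy: reject the first r entries, then accept the
-- first left-to-right maximum (w.r.t. all earlier entries).  Since the
-- entries are ≥ 1 and the running maximum starts at 0, "m < x" is exactly
-- "x is a left-to-right maximum".
strategyGo : ℕ → ℕ → List ℕ → Maybe ℕ
strategyGo k       m []       = nothing
strategyGo zero    m (x ∷ xs) = if m <ᵇ x then just x else strategyGo zero (m ⊔ x) xs
strategyGo (suc k) m (x ∷ xs) = strategyGo k (m ⊔ x) xs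

strategy : ℕ → List ℕ → Maybe ℕ
strategy r π = strategyGo r 0 π

winnableᵇ : ℕ → ℕ → List ℕ → Bool
winnableᵇ N r π with strategy r π
... | just x  = x ≡ᵇ N
... | nothing = false

-- 0-based index of the first occurrence of x in a list, i.e. π⁻¹(x) - 1
index0 : ℕ → List ℕ → ℕ
index0 x []       = 0
index0 x (y ∷ ys) = if x ≡ᵇ y then 0 else suc (index0 x ys)

module _ {c ℓ} (R : CommutativeSemiring c ℓ) where
  open CommutativeSemiring R
  open RS rawSemiring using (_^_)

  W : Carrier → ℕ → ℕ → Carrier
  W θ N r = foldr (λ π acc → (if winnableᵇ N r π then θ ^ index0 N π else 0#) + acc)
                  0# (perms N)

module Submission where

-- Read a permutation of {1,…,N} from the left. After a prefix, the winnable completions, each weighted by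
-- θ^(number of its letters before N), have a total weight depending only on the number k of rejections still to
-- make and on the numbers b and a of unused letters below and above the running maximum; this is winWeight k b a,
-- defined below by conditioning on the next letter, and W_N(r) = winWeight r 0 N. Conditioning instead on the
-- last letter gives
--   winWeight k b (a+1) = b·winWeight k (b−1) (a+1) + a·winWeight k b a + loseCount k b a·θ^(b+a),
-- where loseCount k b a counts the orders of the letters other than N in which nothing is accepted, N being read
-- last. When a ≥ 1 these are the k·(b+a−1)! orders putting the largest of those letters among the first k, so
-- for b = 0 the identity is the recurrence.

open import Defs
open import Data.Nat as ℕ using (ℕ; zero; suc; pred; _≤_; _<_; _∸_; _⊔_; z≤n; s≤s; _!)
import Data.Nat.Properties as ℕₚ
open import Data.Bool using (Bool; true; false; not; _∧_; if_then_else_)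
import Data.Bool as Bool
open import Data.Bool.Properties using (∧-zeroʳ; ∧-identityʳ)
open import Data.List using (List; []; _∷_; _++_; length; map; concat; foldr; filter; applyUpTo; upTo)
open import Data.List.Relation.Unary.All as All using (All; []; _∷_)
open import Data.Product using (_,_)
open import Data.Empty using (⊥; ⊥-elim)
open import Function using (_∘_)
open import Relation.Binary.PropositionalEquality as ≡ using (_≡_; _≢_)
open import Algebra.Bundles using (CommutativeSemiring)
import Algebra.Definitions.RawSemiring as RawSemiringDefs
import Algebra.Properties.Semiring.Mult as SemiringMult
import Algebra.Properties.CommutativeSemigroup as CommutativeSemigroupProperties
import Algebra.Solver.Ring.NaturalCoefficients.Default as NaturalCoefficientSolver

module Words where

  open import Data.Nat using (_+_; _<ᵇ_; _≡ᵇ_)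
  open import Data.Bool using (T; _∨_)
  open import Data.Bool.Properties using (T-≡; T-∧; T-not-≡; ¬-not)
  open import Data.Maybe using (Maybe; just; nothing)
  open import Data.Maybe.Properties using (just-injective)
  open import Data.Product using (_×_; proj₁; proj₂)
  open import Function using (Equivalence)
  open import Relation.Binary.PropositionalEquality
    using (refl; sym; trans; cong; cong₂; subst; module ≡-Reasoning)

  ≡ᵇ-refl : ∀ n → (n ≡ᵇ n) ≡ true
  ≡ᵇ-refl n = Equivalence.to T-≡ (ℕₚ.≡⇒≡ᵇ n n refl)

  ≢⇒≡ᵇ-false : ∀ {m n} → m ≢ n → (m ≡ᵇ n) ≡ false
  ≢⇒≡ᵇ-false {m} {n} m≢n = ¬-not (m≢n ∘ ℕₚ.≡ᵇ⇒≡ m n ∘ Equivalence.from T-≡)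

  ≡ᵇ-sym : ∀ m n → (m ≡ᵇ n) ≡ (n ≡ᵇ m)
  ≡ᵇ-sym zero    zero    = refl
  ≡ᵇ-sym zero    (suc n) = refl
  ≡ᵇ-sym (suc m) zero    = refl
  ≡ᵇ-sym (suc m) (suc n) = ≡ᵇ-sym m n

  ≤⇒<ᵇ-false : ∀ {m n} → n ≤ m → (m <ᵇ n) ≡ false
  ≤⇒<ᵇ-false {m} {n} n≤m =
    ¬-not (λ m<ᵇn → ℕₚ.<⇒≱ (ℕₚ.<ᵇ⇒< m n (Equivalence.from T-≡ m<ᵇn)) n≤m)

  <⇒<ᵇ-true : ∀ {m n} → m < n → (m <ᵇ n) ≡ true
  <⇒<ᵇ-true = Equivalence.to T-≡ ∘ ℕₚ.<⇒<ᵇ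

  accepts : ℕ → Maybe ℕ → Bool
  accepts N (just y) = y ≡ᵇ N
  accepts N nothing  = false

  winnableᵇ-accepts : ∀ N r π → winnableᵇ N r π ≡ accepts N (strategy r π)
  winnableᵇ-accepts N r π with strategy r π
  ... | just y  = refl
  ... | nothing = refl

  strategyGo-low : ∀ {m x} w → x ≤ m → strategyGo 0 m (x ∷ w) ≡ strategyGo 0 (m ⊔ x) w
  strategyGo-low w x≤m rewrite ≤⇒<ᵇ-false x≤m = refl

  strategyGo-high : ∀ {m x} w → m < x → strategyGo 0 m (x ∷ w) ≡ just x
  strategyGo-high w m<x rewrite <⇒<ᵇ-true m<x = refl

  strategyGo-above : ∀ k m w {y} → strategyGo k m w ≡ just y → m < y
  strategyGo-above zero    m (x ∷ w) eq with m <ᵇ x in m<ᵇx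
  ... | true  = subst (m <_) (just-injective eq) (ℕₚ.<ᵇ⇒< m x (Equivalence.from T-≡ m<ᵇx))
  ... | false = ℕₚ.≤-<-trans (ℕₚ.m≤m⊔n m x) (strategyGo-above zero (m ⊔ x) w eq)
  strategyGo-above (suc k) m (x ∷ w) eq = ℕₚ.≤-<-trans (ℕₚ.m≤m⊔n m x) (strategyGo-above k (m ⊔ x) w eq)

  accepts-after : ∀ {N} k m w → N ≤ m → accepts N (strategyGo k m w) ≡ false
  accepts-after {N} k m w N≤m with strategyGo k m w in eq
  ... | nothing = refl
  ... | just y  =
    ≢⇒≡ᵇ-false (λ y≡N → ℕₚ.<⇒≱ (strategyGo-above k m w eq) (subst (_≤ m) (sym y≡N) N≤m))

  avoids : List ℕ → List ℕ → Bool
  avoids U []      = true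
  avoids U (x ∷ w) = not (elemᵇ x U) ∧ avoids U w

  fresh : List ℕ → List ℕ → Bool
  fresh U w = distinctᵇ w ∧ avoids U w

  avoids-[] : ∀ w → avoids [] w ≡ true
  avoids-[] []      = refl
  avoids-[] (x ∷ w) = avoids-[] w

  avoids-∷ : ∀ x U w → avoids (x ∷ U) w ≡ not (elemᵇ x w) ∧ avoids U w
  avoids-∷ x U []      = refl
  avoids-∷ x U (y ∷ w) rewrite avoids-∷ x U w | ≡ᵇ-sym y x with x ≡ᵇ y | elemᵇ y U
  ... | true  | _     = refl
  ... | false | true  = sym (∧-zeroʳ _)
  ... | false | false = refl

  fresh-∷ : ∀ x U w → fresh U (x ∷ w) ≡ not (elemᵇ x U) ∧ fresh (x ∷ U) w
  fresh-∷ x U w rewrite avoids-∷ x U w with elemᵇ x w | elemᵇ x U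
  ... | true  | true  = refl
  ... | true  | false = sym (∧-zeroʳ _)
  ... | false | true  = ∧-zeroʳ _
  ... | false | false = refl

  Distinct : List ℕ → Set
  Distinct U = T (distinctᵇ U)

  Distinct-∷ : ∀ {x U} → elemᵇ x U ≡ false → Distinct U → Distinct (x ∷ U)
  Distinct-∷ x∉U distinct = Equivalence.from T-∧ (Equivalence.from T-not-≡ x∉U , distinct)

  InRange : ℕ → ℕ → Set
  InRange m x = 1 ≤ x × x ≤ m

  InRange-widen : ∀ {m m′} → m ≤ m′ → ∀ {x} → InRange m x → InRange m′ x
  InRange-widen m≤m′ (1≤x , x≤m) = 1≤x , ℕₚ.≤-trans x≤m m≤m′

  elemᵇ-above : ∀ {m x} U → All (InRange m) U → m < x → elemᵇ x U ≡ false
  elemᵇ-above []      []                m<x = refl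
  elemᵇ-above (u ∷ U) ((_ , u≤m) ∷ U≤m) m<x
    rewrite ≢⇒≡ᵇ-false (λ x≡u → ℕₚ.<⇒≱ m<x (subst (_≤ _) (sym x≡u) u≤m))
    = elemᵇ-above U U≤m m<x

  count : ℕ → (ℕ → Bool) → ℕ
  count zero    p = 0
  count (suc n) p = (if p 0 then 1 else 0) + count n (p ∘ suc)

  count-false : ∀ n → count n (λ _ → false) ≡ 0
  count-false zero    = refl
  count-false (suc n) = count-false n

  count-not : ∀ n p → count n (not ∘ p) + count n p ≡ n
  count-not zero    p = refl
  count-not (suc n) p with p 0
  ... | true  = trans (ℕₚ.+-suc _ _) (cong suc (count-not n (p ∘ suc)))
  ... | false = cong suc (count-not n (p ∘ suc))

  count-∨ : ∀ n p q → (∀ i → p i ∧ q i ≡ false) → count n (λ i → p i ∨ q i) ≡ count n p + count n q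
  count-∨ zero    p q disjoint = refl
  count-∨ (suc n) p q disjoint
    with p 0 | q 0 | disjoint 0 | count-∨ n (p ∘ suc) (q ∘ suc) (disjoint ∘ suc)
  ... | true  | false | _ | ih = cong suc ih
  ... | false | true  | _ | ih = trans (cong suc ih) (sym (ℕₚ.+-suc _ _))
  ... | false | false | _ | ih = ih

  count-≡ᵇ : ∀ n u → 1 ≤ u → u ≤ n → count n (λ i → suc i ≡ᵇ u) ≡ 1
  count-≡ᵇ (suc n) (suc zero)    _ _         = cong suc (count-false n)
  count-≡ᵇ (suc n) (suc (suc u)) _ (s≤s u<n) = count-≡ᵇ n (suc u) (s≤s z≤n) u<n

  count-elem : ∀ n U → Distinct U → All (InRange n) U → count n (λ i → elemᵇ (suc i) U) ≡ length U
  count-elem n []      _        []                  = count-false n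
  count-elem n (u ∷ U) distinct ((1≤u , u≤n) ∷ U≤n) = begin
    count n (λ i → (suc i ≡ᵇ u) ∨ elemᵇ (suc i) U)
      ≡⟨ count-∨ n _ _ disjoint ⟩
    count n (λ i → suc i ≡ᵇ u) + count n (λ i → elemᵇ (suc i) U)
      ≡⟨ cong₂ _+_ (count-≡ᵇ n u 1≤u u≤n) (count-elem n U (proj₂ parts) U≤n) ⟩
    suc (length U) ∎
    where
      open ≡-Reasoning
      parts = Equivalence.to T-∧ distinct
      u∉U : elemᵇ u U ≡ false
      u∉U = Equivalence.to T-not-≡ (proj₁ parts)
      disjoint : ∀ i → (suc i ≡ᵇ u) ∧ elemᵇ (suc i) U ≡ false
      disjoint i with suc i ≡ᵇ u in eq
      ... | false = refl
      ... | true rewrite ℕₚ.≡ᵇ⇒≡ (suc i) u (Equivalence.from T-≡ eq) = u∉U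

  count-unused : ∀ n U → Distinct U → All (InRange n) U →
                 count n (λ i → not (elemᵇ (suc i) U)) + length U ≡ n
  count-unused n U distinct U≤n =
    trans (cong (count n (λ i → not (elemᵇ (suc i) U)) +_) (sym (count-elem n U distinct U≤n)))
          (count-not n (λ i → elemᵇ (suc i) U))

  ∸-+-∸ : ∀ {u m n} → u ≤ m → m ≤ n → (m ∸ u) + (n ∸ m) ≡ n ∸ u
  ∸-+-∸ {u} {m} {n} u≤m m≤n = begin
    (m ∸ u) + (n ∸ m)  ≡⟨ ℕₚ.+-comm (m ∸ u) (n ∸ m) ⟩
    (n ∸ m) + (m ∸ u)  ≡⟨ ℕₚ.+-∸-assoc (n ∸ m) u≤m ⟨
    (n ∸ m) + m ∸ u    ≡⟨ cong (_∸ u) (ℕₚ.m∸n+n≡m m≤n) ⟩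
    n ∸ u              ∎
    where open ≡-Reasoning

  complement-unique : ∀ {a u n N} → a + u ≡ N → u + n ≡ N → a ≡ n
  complement-unique {a} {u} {n} a+u≡N u+n≡N =
    ℕₚ.+-cancelʳ-≡ u a n (trans a+u≡N (trans (sym u+n≡N) (ℕₚ.+-comm u n)))

module LoseCounts where

  open import Data.Nat using (_+_; _*_)
  open import Data.Nat.Properties using (+-suc; +-identityʳ; *-zeroʳ)
  open import Data.Nat.Solver using (module +-*-Solver)
  open import Relation.Binary.PropositionalEquality using (refl; sym; subst)
  open +-*-Solver

  mutual
    loseCount : ℕ → ℕ → ℕ → ℕ
    loseCount zero    b zero    = b !
    loseCount zero    b (suc a) = 0
    loseCount (suc k) b a       = b * loseCount k (pred b) a + loseRecordCount k b a

    loseRecordCount : ℕ → ℕ → ℕ → ℕ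
    loseRecordCount k b zero    = 0
    loseRecordCount k b (suc c) = loseCount k b c + loseRecordCount k (suc b) c

  loseCount-accepting-suc : ∀ b a → loseCount 0 (suc b) a ≡ suc b * loseCount 0 b a
  loseCount-accepting-suc b zero    = refl
  loseCount-accepting-suc b (suc a) = sym (*-zeroʳ (suc b))

  loseCount-noHigh : ∀ k b → k ≤ b → loseCount k b 0 ≡ b !
  loseCount-noHigh zero    b       _         = refl
  loseCount-noHigh (suc k) (suc b) (s≤s k≤b) rewrite loseCount-noHigh k b k≤b = +-identityʳ _

  mutual
    loseCount-high : ∀ k b a → k ≤ b + suc a → loseCount k b (suc a) ≡ k * (b + a) !
    loseCount-high zero    b       a       _         = refl
    loseCount-high (suc k) zero    zero    (s≤s z≤n) = refl
    loseCount-high (suc k) zero    (suc a) (s≤s k≤)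
      rewrite loseRecordCount-high k 0 (suc a) k≤ =
        solve 3 (λ a k f → (con 1 :+ a) :* (k :* f) :+ (con 1 :+ a) :* f
                        := (con 1 :+ a) :* f :+ k :* ((con 1 :+ a) :* f))
              refl a k (a !)
    loseCount-high (suc k) (suc b) a       (s≤s k≤)
      rewrite loseCount-high k b a k≤
            | loseRecordCount-high k (suc b) a (subst (k ≤_) (+-suc b a) k≤) =
        solve 4 (λ b a k f → (con 1 :+ b) :* (k :* f) :+ (a :* (k :* f) :+ (con 1 :+ (b :+ a)) :* f)
                          := (con 1 :+ (b :+ a)) :* f :+ k :* ((con 1 :+ (b :+ a)) :* f))
              refl b a k ((b + a) !)

    loseRecordCount-high : ∀ k b a → k ≤ b + a →
                           loseRecordCount k b (suc a) ≡ a * (k * pred (b + a) !) + (b + a) !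
    loseRecordCount-high k b zero    k≤ rewrite +-identityʳ b | loseCount-noHigh k b k≤ = +-identityʳ _
    loseRecordCount-high k b (suc a) k≤
      rewrite loseCount-high k b a k≤
            | loseRecordCount-high k (suc b) a (subst (k ≤_) (+-suc b a) k≤)
            | +-suc b a =
        solve 4 (λ b a k f → k :* f :+ (a :* (k :* f) :+ (con 1 :+ (b :+ a)) :* f)
                          := (con 1 :+ a) :* (k :* f) :+ (con 1 :+ (b :+ a)) :* f)
              refl b a k ((b + a) !)

open Words
open LoseCounts

module Summation {c ℓ} (R : CommutativeSemiring c ℓ) where
  open CommutativeSemiring R hiding (zero)
  open RawSemiringDefs rawSemiring using (_×_)
  open SemiringMult semiring using (×-homo-+; ×1-homo-*; ×-assoc-*; ×-congʳ)
  open CommutativeSemigroupProperties +-commutativeSemigroup using (interchange)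
  open import Relation.Binary.Reasoning.Setoid setoid

  ⟦_⟧ : ℕ → Carrier
  ⟦ n ⟧ = n × 1#

  ⟦+⟧ : ∀ m n → ⟦ m ℕ.+ n ⟧ ≈ ⟦ m ⟧ + ⟦ n ⟧
  ⟦+⟧ = ×-homo-+ 1#

  ⟦*⟧ : ∀ m n → ⟦ m ℕ.* n ⟧ ≈ ⟦ m ⟧ * ⟦ n ⟧
  ⟦*⟧ = ×1-homo-*

  ⟦⟧*≈× : ∀ n x → ⟦ n ⟧ * x ≈ n × x
  ⟦⟧*≈× n x = trans (×-assoc-* n 1# x) (×-congʳ n (*-identityˡ x))

  ⟦⟧*-suc∘pred : ∀ n (f : ℕ → Carrier) → ⟦ n ⟧ * f (suc (pred n)) ≈ ⟦ n ⟧ * f n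
  ⟦⟧*-suc∘pred zero    f = trans (zeroˡ _) (sym (zeroˡ _))
  ⟦⟧*-suc∘pred (suc n) f = refl

  sumList : {A : Set} → List A → (A → Carrier) → Carrier
  sumList xs f = foldr (λ x acc → f x + acc) 0# xs

  sumBelow : ℕ → (ℕ → Carrier) → Carrier
  sumBelow zero    f = 0#
  sumBelow (suc n) f = f 0 + sumBelow n (f ∘ suc)

  module _ {A : Set} where

    sumList-cong : ∀ xs {f g : A → Carrier} → (∀ x → f x ≈ g x) → sumList xs f ≈ sumList xs g
    sumList-cong []       f≈g = refl
    sumList-cong (x ∷ xs) f≈g = +-cong (f≈g x) (sumList-cong xs f≈g)

    sumList-0# : ∀ (xs : List A) → sumList xs (λ _ → 0#) ≈ 0#
    sumList-0# []       = refl
    sumList-0# (x ∷ xs) = trans (+-identityˡ _) (sumList-0# xs)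

    sumList-+ : ∀ xs (f g : A → Carrier) → sumList xs (λ x → f x + g x) ≈ sumList xs f + sumList xs g
    sumList-+ []       f g = sym (+-identityʳ 0#)
    sumList-+ (x ∷ xs) f g = trans (+-congˡ (sumList-+ xs f g)) (interchange _ _ _ _)

    sumList-*ˡ : ∀ xs a (f : A → Carrier) → sumList xs (λ x → a * f x) ≈ a * sumList xs f
    sumList-*ˡ []       a f = sym (zeroʳ a)
    sumList-*ˡ (x ∷ xs) a f = trans (+-congˡ (sumList-*ˡ xs a f)) (sym (distribˡ a _ _))

    sumList-++ : ∀ xs ys (f : A → Carrier) → sumList (xs ++ ys) f ≈ sumList xs f + sumList ys f
    sumList-++ []       ys f = sym (+-identityˡ _)
    sumList-++ (x ∷ xs) ys f = trans (+-congˡ (sumList-++ xs ys f)) (sym (+-assoc _ _ _))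

    sumList-concat : ∀ xss (f : A → Carrier) → sumList (concat xss) f ≈ sumList xss (λ xs → sumList xs f)
    sumList-concat []         f = refl
    sumList-concat (xs ∷ xss) f = trans (sumList-++ xs (concat xss) f) (+-congˡ (sumList-concat xss f))

    sumList-filter : ∀ xs (p : A → Bool) (f : A → Carrier) →
      sumList (filter (λ x → p x Bool.≟ true) xs) f ≈ sumList xs (λ x → if p x then f x else 0#)
    sumList-filter []       p f = refl
    sumList-filter (x ∷ xs) p f with p x
    ... | true  = +-congˡ (sumList-filter xs p f)
    ... | false = trans (sumList-filter xs p f) (sym (+-identityˡ _))

    sumList-sumBelow : ∀ xs n (F : A → ℕ → Carrier) →
      sumList xs (λ x → sumBelow n (F x)) ≈ sumBelow n (λ i → sumList xs (λ x → F x i))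
    sumList-sumBelow xs zero    F = sumList-0# xs
    sumList-sumBelow xs (suc n) F =
      trans (sumList-+ xs (λ x → F x 0) (λ x → sumBelow n (F x ∘ suc)))
            (+-congˡ (sumList-sumBelow xs n (λ x → F x ∘ suc)))

  sumList-map : ∀ {A B : Set} (h : A → B) xs (f : B → Carrier) → sumList (map h xs) f ≡ sumList xs (f ∘ h)
  sumList-map h []       f = ≡.refl
  sumList-map h (x ∷ xs) f = ≡.cong (f (h x) +_) (sumList-map h xs f)

  sumList-applyUpTo : ∀ (h : ℕ → ℕ) n (f : ℕ → Carrier) → sumList (applyUpTo h n) f ≡ sumBelow n (f ∘ h)
  sumList-applyUpTo h zero    f = ≡.refl
  sumList-applyUpTo h (suc n) f = ≡.cong (f (h 0) +_) (sumList-applyUpTo (h ∘ suc) n f)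

  sumBelow-cong : ∀ n {f g : ℕ → Carrier} → (∀ i → i < n → f i ≈ g i) → sumBelow n f ≈ sumBelow n g
  sumBelow-cong zero    f≈g = refl
  sumBelow-cong (suc n) f≈g = +-cong (f≈g 0 (s≤s z≤n)) (sumBelow-cong n (λ i i<n → f≈g (suc i) (s≤s i<n)))

  sumBelow-0# : ∀ n {f : ℕ → Carrier} → (∀ i → i < n → f i ≈ 0#) → sumBelow n f ≈ 0#
  sumBelow-0# zero    f≈0 = refl
  sumBelow-0# (suc n) f≈0 =
    trans (+-cong (f≈0 0 (s≤s z≤n)) (sumBelow-0# n (λ i i<n → f≈0 (suc i) (s≤s i<n)))) (+-identityˡ 0#)

  sumBelow-*ˡ : ∀ n a (f : ℕ → Carrier) → sumBelow n (λ i → a * f i) ≈ a * sumBelow n f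
  sumBelow-*ˡ zero    a f = sym (zeroʳ a)
  sumBelow-*ˡ (suc n) a f = trans (+-congˡ (sumBelow-*ˡ n a (f ∘ suc))) (sym (distribˡ a _ _))

  sumBelow-+ : ∀ m n (f : ℕ → Carrier) → sumBelow (m ℕ.+ n) f ≈ sumBelow m f + sumBelow n (λ i → f (m ℕ.+ i))
  sumBelow-+ zero    n f = sym (+-identityˡ _)
  sumBelow-+ (suc m) n f = trans (+-congˡ (sumBelow-+ m n (f ∘ suc))) (sym (+-assoc _ _ _))

  sumBelow-suc : ∀ n (f : ℕ → Carrier) → sumBelow (suc n) f ≈ sumBelow n f + f n
  sumBelow-suc n f = begin
    sumBelow (suc n) f
      ≡⟨ ≡.cong (λ k → sumBelow k f) (ℕₚ.+-comm 1 n) ⟩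
    sumBelow (n ℕ.+ 1) f
      ≈⟨ sumBelow-+ n 1 f ⟩
    sumBelow n f + (f (n ℕ.+ 0) + 0#)
      ≈⟨ +-congˡ (trans (+-identityʳ _) (reflexive (≡.cong f (ℕₚ.+-identityʳ n)))) ⟩
    sumBelow n f + f n ∎

  sumBelow-count : ∀ n (p : ℕ → Bool) c → sumBelow n (λ i → if p i then c else 0#) ≈ ⟦ count n p ⟧ * c
  sumBelow-count zero    p c = sym (zeroˡ c)
  sumBelow-count (suc n) p c = begin
    (if p 0 then c else 0#) + sumBelow n (λ i → if p (suc i) then c else 0#)
      ≈⟨ +-cong (indicator (p 0)) (sumBelow-count n (p ∘ suc) c) ⟩
    ⟦ if p 0 then 1 else 0 ⟧ * c + ⟦ count n (p ∘ suc) ⟧ * c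
      ≈⟨ distribʳ c _ _ ⟨
    (⟦ if p 0 then 1 else 0 ⟧ + ⟦ count n (p ∘ suc) ⟧) * c
      ≈⟨ *-congʳ (⟦+⟧ (if p 0 then 1 else 0) (count n (p ∘ suc))) ⟨
    ⟦ count (suc n) p ⟧ * c ∎
    where
      indicator : ∀ b → (if b then c else 0#) ≈ ⟦ if b then 1 else 0 ⟧ * c
      indicator true  = sym (trans (*-congʳ (+-identityʳ 1#)) (*-identityˡ c))
      indicator false = sym (zeroˡ c)

module WinWeights {c ℓ} (R : CommutativeSemiring c ℓ) (θ : CommutativeSemiring.Carrier R) where
  open CommutativeSemiring R hiding (zero)
  open RawSemiringDefs rawSemiring using (_^_)
  open Summation R
  open NaturalCoefficientSolver R using (solve; _:=_; _:+_; _:*_; con)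
  open import Relation.Binary.Reasoning.Setoid setoid

  -- The cases are the next letter: one of the b letters below the maximum, or one above it, which is accepted
  -- if k = 0 and otherwise becomes the new maximum (recordWeight sums over which one; rejecting N loses).
  -- Only a ≥ 1 occurs, as N is still unread.
  mutual
    winWeight : ℕ → ℕ → ℕ → Carrier
    winWeight zero    zero    a = ⟦ pred a ! ⟧
    winWeight zero    (suc b) a = ⟦ suc b ⟧ * (θ * winWeight zero b a) + ⟦ (b ℕ.+ a) ! ⟧
    winWeight (suc k) b       a = ⟦ b ⟧ * (θ * winWeight k (pred b) a) + θ * recordWeight k b (pred a)

    recordWeight : ℕ → ℕ → ℕ → Carrier
    recordWeight k b zero    = 0#
    recordWeight k b (suc c) = winWeight k b (suc c) + recordWeight k (suc b) c

  winWeight-accepting : ∀ b a → winWeight 0 b a ≈ ⟦ b ⟧ * (θ * winWeight 0 (pred b) a) + ⟦ pred (b ℕ.+ a) ! ⟧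
  winWeight-accepting zero    a = sym (trans (+-congʳ (zeroˡ _)) (+-identityˡ _))
  winWeight-accepting (suc b) a = refl

  recordWeight-unfold : ∀ k b c →
    ⟦ c ⟧ * recordWeight k b c ≈ ⟦ c ⟧ * (winWeight k b c + recordWeight k (suc b) (pred c))
  recordWeight-unfold k b c = begin
    ⟦ c ⟧ * recordWeight k b c
      ≈⟨ ⟦⟧*-suc∘pred c (recordWeight k b) ⟨
    ⟦ c ⟧ * recordWeight k b (suc (pred c))
      ≈⟨ ⟦⟧*-suc∘pred c (λ x → winWeight k b x + recordWeight k (suc b) (pred c)) ⟩
    ⟦ c ⟧ * (winWeight k b c + recordWeight k (suc b) (pred c)) ∎

  recordWeight-sum : ∀ k b c → recordWeight k b c ≈ sumBelow c (λ t → winWeight k (b ℕ.+ t) (c ∸ t))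
  recordWeight-sum k b zero    = refl
  recordWeight-sum k b (suc c) =
    +-cong (reflexive (≡.cong (λ x → winWeight k x (suc c)) (≡.sym (ℕₚ.+-identityʳ b))))
           (trans (recordWeight-sum k (suc b) c)
                  (sumBelow-cong c (λ t _ →
                     reflexive (≡.cong (λ x → winWeight k x (c ∸ t)) (≡.sym (ℕₚ.+-suc b t))))))

  winWeight-accepting-lastLetter : ∀ b a →
    winWeight 0 b (suc a) ≈
    ⟦ b ⟧ * winWeight 0 (pred b) (suc a) + ⟦ a ⟧ * winWeight 0 b a + ⟦ loseCount 0 b a ⟧ * θ ^ (b ℕ.+ a)
  winWeight-accepting-lastLetter zero zero =
    solve 2 (λ x y → con 1 :+ con 0 := con 0 :* x :+ con 0 :* y :+ (con 1 :+ con 0) :* con 1)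
          refl (winWeight 0 0 1) (winWeight 0 0 0)
  winWeight-accepting-lastLetter zero (suc a) = begin
    ⟦ suc a ℕ.* a ! ⟧
      ≈⟨ ⟦*⟧ (suc a) (a !) ⟩
    ⟦ suc a ⟧ * ⟦ a ! ⟧
      ≈⟨ solve 3 (λ x y t → y := con 0 :* x :+ y :+ con 0 :* t)
               refl (winWeight 0 0 (suc (suc a))) (⟦ suc a ⟧ * ⟦ a ! ⟧) (θ ^ suc a) ⟩
    0# * winWeight 0 0 (suc (suc a)) + ⟦ suc a ⟧ * winWeight 0 0 (suc a) + 0# * θ ^ suc a ∎
  winWeight-accepting-lastLetter (suc b) a = begin
    B * (θ * winWeight 0 b (suc a)) + ⟦ (b ℕ.+ suc a) ! ⟧
      ≈⟨ +-cong (*-congˡ (*-congˡ (winWeight-accepting-lastLetter b a))) factorial ⟩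
    B * (θ * (B′ * X + A * Y + e * T)) + (B * F + A * F)
      ≈⟨ solve 9 (λ B B′ A th X Y e T F →
                    B :* (th :* (B′ :* X :+ A :* Y :+ e :* T)) :+ (B :* F :+ A :* F)
                 := B :* (B′ :* (th :* X) :+ F) :+ A :* (B :* (th :* Y) :+ F) :+ (B :* e) :* (th :* T))
               refl B B′ A θ X Y e T F ⟩
    B * (B′ * (θ * X) + F) + A * (B * (θ * Y) + F) + (B * e) * (θ * T)
      ≈⟨ +-cong (+-congʳ (*-congˡ unfold)) (*-congʳ lose) ⟩
    B * winWeight 0 b (suc a) + A * winWeight 0 (suc b) a + ⟦ loseCount 0 (suc b) a ⟧ * θ ^ (suc b ℕ.+ a) ∎
    where
      B = ⟦ suc b ⟧
      B′ = ⟦ b ⟧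
      A = ⟦ a ⟧
      X = winWeight 0 (pred b) (suc a)
      Y = winWeight 0 b a
      e = ⟦ loseCount 0 b a ⟧
      T = θ ^ (b ℕ.+ a)
      F = ⟦ (b ℕ.+ a) ! ⟧
      factorial : ⟦ (b ℕ.+ suc a) ! ⟧ ≈ B * F + A * F
      factorial = begin
        ⟦ (b ℕ.+ suc a) ! ⟧                ≡⟨ ≡.cong (λ n → ⟦ n ! ⟧) (ℕₚ.+-suc b a) ⟩
        ⟦ (suc b ℕ.+ a) ℕ.* (b ℕ.+ a) ! ⟧  ≈⟨ ⟦*⟧ (suc b ℕ.+ a) ((b ℕ.+ a) !) ⟩
        ⟦ suc b ℕ.+ a ⟧ * F                ≈⟨ *-congʳ (⟦+⟧ (suc b) a) ⟩
        (B + A) * F                        ≈⟨ distribʳ F B A ⟩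
        B * F + A * F                      ∎
      unfold : B′ * (θ * X) + F ≈ winWeight 0 b (suc a)
      unfold = sym (trans (winWeight-accepting b (suc a))
                          (+-congˡ (reflexive (≡.cong (λ n → ⟦ pred n ! ⟧) (ℕₚ.+-suc b a)))))
      lose : B * e ≈ ⟦ loseCount 0 (suc b) a ⟧
      lose = sym (trans (reflexive (≡.cong ⟦_⟧ (loseCount-accepting-suc b a))) (⟦*⟧ (suc b) (loseCount 0 b a)))

  mutual
    winWeight-lastLetter : ∀ k b a →
      winWeight k b (suc a) ≈
      ⟦ b ⟧ * winWeight k (pred b) (suc a) + ⟦ a ⟧ * winWeight k b a + ⟦ loseCount k b a ⟧ * θ ^ (b ℕ.+ a)
    winWeight-lastLetter zero    b a = winWeight-accepting-lastLetter b a
    winWeight-lastLetter (suc k) b a = begin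
      B * (θ * winWeight k (pred b) (suc a)) + θ * recordWeight k b a
        ≈⟨ +-cong (*-congˡ (*-congˡ (winWeight-lastLetter k (pred b) a))) (recordWeight-lastLetter k b a) ⟩
      B * (θ * (B′ * X + A * Y + e * T)) + (θ * (B * Q + A * Q′) + q * U)
        ≈⟨ solve 12 (λ B B′ A th X Y e T Q Q′ q U →
                       B :* (th :* (B′ :* X :+ A :* Y :+ e :* T)) :+ (th :* (B :* Q :+ A :* Q′) :+ q :* U)
                    := B :* (B′ :* (th :* X) :+ th :* Q) :+ A :* (B :* (th :* Y) :+ th :* Q′)
                       :+ (B :* (e :* (th :* T)) :+ q :* U))
                 refl B B′ A θ X Y e T Q Q′ q U ⟩
      B * (B′ * (θ * X) + θ * Q) + A * (B * (θ * Y) + θ * Q′) + (B * (e * (θ * T)) + q * U)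
        ≈⟨ +-congˡ (+-congʳ (⟦⟧*-suc∘pred b (λ n → e * θ ^ (n ℕ.+ a)))) ⟩
      B * winWeight (suc k) (pred b) (suc a) + A * winWeight (suc k) b a + (B * (e * U) + q * U)
        ≈⟨ +-congˡ (trans (+-congʳ (sym (*-assoc B e U))) (sym (distribʳ U (B * e) q))) ⟩
      B * winWeight (suc k) (pred b) (suc a) + A * winWeight (suc k) b a + (B * e + q) * U
        ≈⟨ +-congˡ (*-congʳ lose) ⟩
      B * winWeight (suc k) (pred b) (suc a) + A * winWeight (suc k) b a + ⟦ loseCount (suc k) b a ⟧ * U ∎
      where
        B = ⟦ b ⟧
        B′ = ⟦ pred b ⟧
        A = ⟦ a ⟧
        X = winWeight k (pred (pred b)) (suc a)
        Y = winWeight k (pred b) a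
        e = ⟦ loseCount k (pred b) a ⟧
        T = θ ^ (pred b ℕ.+ a)
        Q = recordWeight k (pred b) a
        Q′ = recordWeight k b (pred a)
        q = ⟦ loseRecordCount k b a ⟧
        U = θ ^ (b ℕ.+ a)
        lose : B * e + q ≈ ⟦ loseCount (suc k) b a ⟧
        lose = sym (trans (⟦+⟧ (b ℕ.* loseCount k (pred b) a) (loseRecordCount k b a))
                          (+-congʳ (⟦*⟧ b (loseCount k (pred b) a))))

    recordWeight-lastLetter : ∀ k b a →
      θ * recordWeight k b a ≈
      θ * (⟦ b ⟧ * recordWeight k (pred b) a + ⟦ a ⟧ * recordWeight k b (pred a))
      + ⟦ loseRecordCount k b a ⟧ * θ ^ (b ℕ.+ a)
    recordWeight-lastLetter k b zero =
      solve 4 (λ th B Z T → th :* con 0 := th :* (B :* con 0 :+ con 0 :* Z) :+ con 0 :* T)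
            refl θ ⟦ b ⟧ (recordWeight k b 0) (θ ^ (b ℕ.+ 0))
    recordWeight-lastLetter k b (suc c) = begin
      θ * (winWeight k b (suc c) + recordWeight k (suc b) c)
        ≈⟨ distribˡ θ _ _ ⟩
      θ * winWeight k b (suc c) + θ * recordWeight k (suc b) c
        ≈⟨ +-cong (*-congˡ (winWeight-lastLetter k b c)) (recordWeight-lastLetter k (suc b) c) ⟩
      θ * (B * X + C * Y + e * T) + (θ * ((1# + B) * Q + C * Q′) + q * (θ * T))
        ≈⟨ solve 10 (λ th B X C Y e T Q Q′ q →
                       th :* (B :* X :+ C :* Y :+ e :* T) :+ (th :* ((con 1 :+ B) :* Q :+ C :* Q′) :+ q :* (th :* T))
                    := th :* (B :* (X :+ Q) :+ (Q :+ C :* (Y :+ Q′))) :+ (e :+ q) :* (th :* T))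
                 refl θ B X C Y e T Q Q′ q ⟩
      θ * (B * (X + Q) + (Q + C * (Y + Q′))) + (e + q) * (θ * T)
        ≈⟨ +-cong (*-congˡ (+-cong (sym (⟦⟧*-suc∘pred b (λ n → X + recordWeight k n c)))
                                   (trans (+-congˡ (sym (recordWeight-unfold k b c))) oneMore)))
                  (*-cong (sym (⟦+⟧ (loseCount k b c) (loseRecordCount k (suc b) c)))
                          (reflexive (≡.cong (θ ^_) (≡.sym (ℕₚ.+-suc b c))))) ⟩
      θ * (B * recordWeight k (pred b) (suc c) + ⟦ suc c ⟧ * recordWeight k b c)
      + ⟦ loseRecordCount k b (suc c) ⟧ * θ ^ (b ℕ.+ suc c) ∎
      where
        B = ⟦ b ⟧
        C = ⟦ c ⟧
        X = winWeight k (pred b) (suc c)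
        Y = winWeight k b c
        e = ⟦ loseCount k b c ⟧
        T = θ ^ (b ℕ.+ c)
        Q = recordWeight k b c
        Q′ = recordWeight k (suc b) (pred c)
        q = ⟦ loseRecordCount k (suc b) c ⟧
        oneMore : Q + C * Q ≈ ⟦ suc c ⟧ * Q
        oneMore = sym (trans (distribʳ Q 1# C) (+-congʳ (*-identityˡ Q)))

module Winnable {c ℓ} (R : CommutativeSemiring c ℓ) (θ : CommutativeSemiring.Carrier R) where
  open CommutativeSemiring R hiding (zero)
  open RawSemiringDefs rawSemiring using (_^_)
  open Summation R
  open WinWeights R θ
  open import Relation.Binary.Reasoning.Setoid setoid

  θ-if : ∀ b y → (if b then θ * y else 0#) ≈ θ * (if b then y else 0#)
  θ-if true  y = refl
  θ-if false y = sym (zeroʳ θ)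

  module _ (N : ℕ) where

    term : List ℕ → ℕ → ℕ → List ℕ → Carrier
    term U k m w = if fresh U w ∧ accepts N (strategyGo k m w) then θ ^ index0 N w else 0#

    sumList-words : ∀ n (g : List ℕ → Carrier) →
      sumList (words N (suc n)) g ≈ sumBelow N (λ i → sumList (words N n) (λ w → g (suc i ∷ w)))
    sumList-words n g = begin
      sumList (words N (suc n)) g
        ≈⟨ sumList-concat (map row (words N n)) g ⟩
      sumList (map row (words N n)) (λ xs → sumList xs g)
        ≡⟨ sumList-map row (words N n) _ ⟩
      sumList (words N n) (λ w → sumList (row w) g)
        ≈⟨ sumList-cong (words N n) (λ w → reflexive (row-sum w)) ⟩
      sumList (words N n) (λ w → sumBelow N (λ i → g (suc i ∷ w)))
        ≈⟨ sumList-sumBelow (words N n) N (λ w i → g (suc i ∷ w)) ⟩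
      sumBelow N (λ i → sumList (words N n) (λ w → g (suc i ∷ w))) ∎
      where
        row : List ℕ → List (List ℕ)
        row w = map (λ x → x ∷ w) (range1 N)
        row-sum : ∀ w → sumList (row w) g ≡ sumBelow N (λ i → g (suc i ∷ w))
        row-sum w = ≡.trans (sumList-map (λ x → x ∷ w) (range1 N) g)
                            (≡.trans (sumList-map suc (upTo N) _) (sumList-applyUpTo (λ i → i) N _))

    sumList-fresh : ∀ n {U} → Distinct U → All (InRange N) U → length U ℕ.+ n ≡ N →
                    sumList (words N n) (λ w → if fresh U w then 1# else 0#) ≈ ⟦ n ! ⟧
    sumList-fresh zero    _        _   _    = refl
    sumList-fresh (suc n) {U} distinct U≤N size = begin
      sumList (words N (suc n)) indicator
        ≈⟨ sumList-words n indicator ⟩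
      sumBelow N (λ i → sumList (words N n) (λ w → indicator (suc i ∷ w)))
        ≈⟨ sumBelow-cong N (λ i i<N → letter i i<N (elemᵇ (suc i) U) ≡.refl) ⟩
      sumBelow N (λ i → if not (elemᵇ (suc i) U) then ⟦ n ! ⟧ else 0#)
        ≈⟨ sumBelow-count N _ _ ⟩
      ⟦ count N (λ i → not (elemᵇ (suc i) U)) ⟧ * ⟦ n ! ⟧
        ≡⟨ ≡.cong (λ k → ⟦ k ⟧ * ⟦ n ! ⟧)
                  (complement-unique {u = length U} (count-unused N U distinct U≤N) size) ⟩
      ⟦ suc n ⟧ * ⟦ n ! ⟧
        ≈⟨ ⟦*⟧ (suc n) (n !) ⟨
      ⟦ suc n ! ⟧ ∎
      where
        indicator : List ℕ → Carrier
        indicator w = if fresh U w then 1# else 0#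
        letter : ∀ i → i < N → ∀ e → elemᵇ (suc i) U ≡ e →
          sumList (words N n) (λ w → indicator (suc i ∷ w)) ≈ (if not e then ⟦ n ! ⟧ else 0#)
        letter i i<N e x∈U = trans (sumList-cong (words N n) (reflexive ∘ unfold)) (byMembership e x∈U)
          where
            unfold : ∀ w → indicator (suc i ∷ w) ≡ (if not e ∧ fresh (suc i ∷ U) w then 1# else 0#)
            unfold w = ≡.cong (λ b → if b then 1# else 0#)
                              (≡.trans (fresh-∷ (suc i) U w) (≡.cong (λ b → not b ∧ fresh (suc i ∷ U) w) x∈U))
            byMembership : ∀ e → elemᵇ (suc i) U ≡ e →
              sumList (words N n) (λ w → if not e ∧ fresh (suc i ∷ U) w then 1# else 0#)
              ≈ (if not e then ⟦ n ! ⟧ else 0#)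
            byMembership true  _   = sumList-0# (words N n)
            byMembership false x∉U = sumList-fresh n (Distinct-∷ {suc i} {U} x∉U distinct) ((s≤s z≤n , i<N) ∷ U≤N)
                                                   (≡.trans (≡.sym (ℕₚ.+-suc (length U) n)) size)

    record State (U : List ℕ) (m n : ℕ) : Set where
      field
        distinct : Distinct U
        bounded  : All (InRange m) U
        m<N      : m < N
        size     : length U ℕ.+ n ≡ N

    SumFormula : ℕ → Set ℓ
    SumFormula n = ∀ {U m} k → State U m n →
                   sumList (words N n) (term U k m) ≈ winWeight k (m ∸ length U) (N ∸ m)

    module _ {U m n} (st : State U m n) where
      open State st

      unused-below : count m (λ i → not (elemᵇ (suc i) U)) ≡ m ∸ length U
      unused-below = ≡.trans (≡.sym (ℕₚ.m+n∸n≡m _ (length U)))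
                             (≡.cong (_∸ length U) (count-unused m U distinct bounded))

      length≤ : length U ≤ m
      length≤ = ≡.subst (length U ≤_) (count-unused m U distinct bounded) (ℕₚ.m≤n+m (length U) _)

      remaining : (m ∸ length U) ℕ.+ (N ∸ m) ≡ n
      remaining = ≡.trans (∸-+-∸ length≤ (ℕₚ.<⇒≤ m<N))
                          (≡.trans (≡.cong (_∸ length U) (≡.sym size)) (ℕₚ.m+n∸m≡n (length U) n))

    State-empty : ∀ {U m} → State U m 0 → ⊥
    State-empty {U} st =
      ℕₚ.<⇒≱ m<N (≡.subst (_≤ _) (≡.trans (≡.sym (ℕₚ.+-identityʳ (length U))) size) (length≤ st))
      where open State st

    State-∷ : ∀ {U m n x} → State U m (suc n) → elemᵇ x U ≡ false → 1 ≤ x → x < N →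
              State (x ∷ U) (m ⊔ x) n
    State-∷ {U} {m} {n} {x} st x∉U 1≤x x<N = record
      { distinct = Distinct-∷ {x} {U} x∉U distinct
      ; bounded  = (1≤x , ℕₚ.m≤n⊔m m x) ∷ All.map (InRange-widen (ℕₚ.m≤m⊔n m x)) bounded
      ; m<N      = ℕₚ.⊔-pres-<m m<N x<N
      ; size     = ≡.trans (≡.sym (ℕₚ.+-suc (length U) n)) size
      }
      where open State st

    term-used : ∀ {U k m x} w → elemᵇ x U ≡ true → term U k m (x ∷ w) ≡ 0#
    term-used {U} {x = x} w x∈U rewrite fresh-∷ x U w | x∈U = ≡.refl

    term-passed : ∀ {U k m x} w → elemᵇ x U ≡ false → x ≢ N →
                  strategyGo k m (x ∷ w) ≡ strategyGo (pred k) (m ⊔ x) w →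
                  term U k m (x ∷ w) ≈ θ * term (x ∷ U) (pred k) (m ⊔ x) w
    term-passed {U} {x = x} w x∉U x≢N passes
      rewrite fresh-∷ x U w | x∉U | passes | ≢⇒≡ᵇ-false (x≢N ∘ ≡.sym) = θ-if _ _

    module Step {n} (ih : SumFormula n) {U m} (st : State U m (suc n)) where
      open State st

      b a′ : ℕ
      b  = m ∸ length U
      a′ = N ∸ suc m

      N≡ : N ≡ suc (m ℕ.+ a′)
      N≡ = ≡.sym (ℕₚ.m+[n∸m]≡n m<N)

      letterSum : ℕ → ℕ → Carrier
      letterSum k x = sumList (words N n) (λ w → term U k m (x ∷ w))

      lowLetters highLetters : ℕ → Carrier
      lowLetters  k = sumBelow m (λ i → letterSum k (suc i))
      highLetters k = sumBelow a′ (λ t → letterSum k (suc (m ℕ.+ t)))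

      byLetter : ∀ k → sumList (words N (suc n)) (term U k m) ≈ lowLetters k + (highLetters k + letterSum k N)
      byLetter k = begin
        sumList (words N (suc n)) (term U k m)
          ≈⟨ sumList-words n (term U k m) ⟩
        sumBelow N (λ i → letterSum k (suc i))
          ≡⟨ ≡.cong (λ M → sumBelow M (λ i → letterSum k (suc i)))
                    (≡.trans N≡ (≡.sym (ℕₚ.+-suc m a′))) ⟩
        sumBelow (m ℕ.+ suc a′) (λ i → letterSum k (suc i))
          ≈⟨ sumBelow-+ m (suc a′) _ ⟩
        lowLetters k + sumBelow (suc a′) (λ t → letterSum k (suc (m ℕ.+ t)))
          ≈⟨ +-congˡ (sumBelow-suc a′ _) ⟩
        lowLetters k + (highLetters k + letterSum k (suc (m ℕ.+ a′)))
          ≡⟨ ≡.cong (λ x → lowLetters k + (highLetters k + letterSum k x)) (≡.sym N≡) ⟩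
        lowLetters k + (highLetters k + letterSum k N) ∎

      letterSum-passed : ∀ {k x} → elemᵇ x U ≡ false → 1 ≤ x → x < N →
        (∀ w → strategyGo k m (x ∷ w) ≡ strategyGo (pred k) (m ⊔ x) w) →
        letterSum k x ≈ θ * winWeight (pred k) ((m ⊔ x) ∸ suc (length U)) (N ∸ (m ⊔ x))
      letterSum-passed {k} {x} x∉U 1≤x x<N passes = begin
        letterSum k x
          ≈⟨ sumList-cong (words N n) (λ w → term-passed {U} {k} {m} w x∉U (ℕₚ.<⇒≢ x<N) (passes w)) ⟩
        sumList (words N n) (λ w → θ * term (x ∷ U) (pred k) (m ⊔ x) w)
          ≈⟨ sumList-*ˡ (words N n) θ _ ⟩
        θ * sumList (words N n) (term (x ∷ U) (pred k) (m ⊔ x))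
          ≈⟨ *-congˡ (ih (pred k) (State-∷ st x∉U 1≤x x<N)) ⟩
        θ * winWeight (pred k) ((m ⊔ x) ∸ suc (length U)) (N ∸ (m ⊔ x)) ∎

      passes-low : ∀ k {x} → x ≤ m → ∀ w → strategyGo k m (x ∷ w) ≡ strategyGo (pred k) (m ⊔ x) w
      passes-low zero    x≤m w = strategyGo-low w x≤m
      passes-low (suc k) x≤m w = ≡.refl

      lowLetter : ∀ k i → suc i ≤ m → ∀ e → elemᵇ (suc i) U ≡ e →
        letterSum k (suc i) ≈ (if not e then θ * winWeight (pred k) (pred b) (N ∸ m) else 0#)
      lowLetter k i x≤m true  x∈U =
        trans (sumList-cong (words N n) (λ w → reflexive (term-used {U} {k} {m} w x∈U))) (sumList-0# (words N n))
      lowLetter k i x≤m false x∉U =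
        trans (letterSum-passed {k} x∉U (s≤s z≤n) (ℕₚ.≤-<-trans x≤m m<N) (passes-low k x≤m))
              (reflexive (≡.cong₂ (λ p q → θ * winWeight (pred k) p q)
                 (≡.trans (≡.cong (_∸ suc (length U)) m⊔x≡m)
                          (≡.sym (ℕₚ.pred[m∸n]≡m∸[1+n] m (length U))))
                 (≡.cong (N ∸_) m⊔x≡m)))
        where
          m⊔x≡m : m ⊔ suc i ≡ m
          m⊔x≡m = ℕₚ.m≥n⇒m⊔n≡m x≤m

      lowLetters≈ : ∀ k → lowLetters k ≈ ⟦ b ⟧ * (θ * winWeight (pred k) (pred b) (N ∸ m))
      lowLetters≈ k = begin
        lowLetters k
          ≈⟨ sumBelow-cong m (λ i i<m → lowLetter k i i<m (elemᵇ (suc i) U) ≡.refl) ⟩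
        sumBelow m (λ i → if not (elemᵇ (suc i) U) then θ * winWeight (pred k) (pred b) (N ∸ m) else 0#)
          ≈⟨ sumBelow-count m _ _ ⟩
        ⟦ count m (λ i → not (elemᵇ (suc i) U)) ⟧ * (θ * winWeight (pred k) (pred b) (N ∸ m))
          ≡⟨ ≡.cong (λ c → ⟦ c ⟧ * (θ * winWeight (pred k) (pred b) (N ∸ m))) (unused-below st) ⟩
        ⟦ b ⟧ * (θ * winWeight (pred k) (pred b) (N ∸ m)) ∎

      module HighLetter {t} (t<a′ : t < a′) where
        x : ℕ
        x = suc (m ℕ.+ t)

        m<x : m < x
        m<x = s≤s (ℕₚ.m≤m+n m t)

        x<N : x < N
        x<N = ≡.subst (x <_) (≡.sym N≡) (s≤s (ℕₚ.+-monoʳ-< m t<a′))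

        rejected : ∀ k → letterSum (suc k) x ≈ θ * winWeight k (b ℕ.+ t) (a′ ∸ t)
        rejected k = trans (letterSum-passed {suc k} (elemᵇ-above U bounded m<x) (s≤s z≤n) x<N (λ w → ≡.refl))
          (reflexive (≡.cong₂ (λ p q → θ * winWeight k p q)
            (≡.trans (≡.cong (_∸ suc (length U)) m⊔x≡x) (ℕₚ.+-∸-comm t (length≤ st)))
            (≡.trans (≡.cong (N ∸_) m⊔x≡x)
                     (≡.trans (≡.cong (_∸ x) N≡) (ℕₚ.[m+n]∸[m+o]≡n∸o m a′ t)))))
          where
            m⊔x≡x : m ⊔ x ≡ x
            m⊔x≡x = ℕₚ.m≤n⇒m⊔n≡n (ℕₚ.<⇒≤ m<x)

        accepted : letterSum 0 x ≈ 0#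
        accepted = trans (sumList-cong (words N n) (λ w → reflexive (loses w))) (sumList-0# (words N n))
          where
            loses : ∀ w → term U 0 m (x ∷ w) ≡ 0#
            loses w rewrite strategyGo-high w m<x | ≢⇒≡ᵇ-false (ℕₚ.<⇒≢ x<N)
                          | ∧-zeroʳ (fresh U (x ∷ w)) = ≡.refl

      N∉U : elemᵇ N U ≡ false
      N∉U = elemᵇ-above U bounded m<N

      topLetter-accepted : letterSum 0 N ≈ ⟦ n ! ⟧
      topLetter-accepted = trans (sumList-cong (words N n) (λ w → reflexive (wins w)))
        (sumList-fresh n (Distinct-∷ {N} {U} N∉U distinct)
                         ((ℕₚ.≤-<-trans z≤n m<N , ℕₚ.≤-refl) ∷ All.map (InRange-widen (ℕₚ.<⇒≤ m<N)) bounded)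
                         (≡.trans (≡.sym (ℕₚ.+-suc (length U) n)) size))
        where
          wins : ∀ w → term U 0 m (N ∷ w) ≡ (if fresh (N ∷ U) w then 1# else 0#)
          wins w rewrite fresh-∷ N U w | N∉U | strategyGo-high w m<N | ≡ᵇ-refl N
                       | ∧-identityʳ (fresh (N ∷ U) w) = ≡.refl

      topLetter-rejected : ∀ k → letterSum (suc k) N ≈ 0#
      topLetter-rejected k = trans (sumList-cong (words N n) (λ w → reflexive (loses w))) (sumList-0# (words N n))
        where
          loses : ∀ w → term U (suc k) m (N ∷ w) ≡ 0#
          loses w rewrite accepts-after {N} k (m ⊔ N) w (ℕₚ.m≤n⊔m m N) | ∧-zeroʳ (fresh U (N ∷ w)) = ≡.refl

      accepting : sumList (words N (suc n)) (term U 0 m) ≈ winWeight 0 b (N ∸ m)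
      accepting = begin
        sumList (words N (suc n)) (term U 0 m)
          ≈⟨ byLetter 0 ⟩
        lowLetters 0 + (highLetters 0 + letterSum 0 N)
          ≈⟨ +-cong (lowLetters≈ 0)
                    (+-cong (sumBelow-0# a′ (λ t t<a′ → HighLetter.accepted t<a′)) topLetter-accepted) ⟩
        lowPart + (0# + ⟦ n ! ⟧)
          ≈⟨ +-congˡ (+-identityˡ _) ⟩
        lowPart + ⟦ n ! ⟧
          ≡⟨ ≡.cong (λ k → lowPart + ⟦ pred k ! ⟧) (≡.sym (remaining st)) ⟩
        lowPart + ⟦ pred (b ℕ.+ (N ∸ m)) ! ⟧
          ≈⟨ winWeight-accepting b (N ∸ m) ⟨
        winWeight 0 b (N ∸ m) ∎
        where lowPart = ⟦ b ⟧ * (θ * winWeight 0 (pred b) (N ∸ m))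

      rejecting : ∀ k → sumList (words N (suc n)) (term U (suc k) m) ≈ winWeight (suc k) b (N ∸ m)
      rejecting k = begin
        sumList (words N (suc n)) (term U (suc k) m)
          ≈⟨ byLetter (suc k) ⟩
        lowLetters (suc k) + (highLetters (suc k) + letterSum (suc k) N)
          ≈⟨ +-cong (lowLetters≈ (suc k))
                    (+-cong (sumBelow-cong a′ (λ t t<a′ → HighLetter.rejected t<a′ k)) (topLetter-rejected k)) ⟩
        lowPart + (sumBelow a′ (λ t → θ * winWeight k (b ℕ.+ t) (a′ ∸ t)) + 0#)
          ≈⟨ +-congˡ (trans (+-identityʳ _) (sumBelow-*ˡ a′ θ _)) ⟩
        lowPart + θ * sumBelow a′ (λ t → winWeight k (b ℕ.+ t) (a′ ∸ t))
          ≈⟨ +-congˡ (*-congˡ (recordWeight-sum k b a′)) ⟨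
        lowPart + θ * recordWeight k b a′
          ≡⟨ ≡.cong (λ c → lowPart + θ * recordWeight k b c) (≡.sym (ℕₚ.pred[m∸n]≡m∸[1+n] N m)) ⟩
        winWeight (suc k) b (N ∸ m) ∎
        where lowPart = ⟦ b ⟧ * (θ * winWeight k (pred b) (N ∸ m))

    sumFormula : ∀ n → SumFormula n
    sumFormula zero    k       st = ⊥-elim (State-empty st)
    sumFormula (suc n) zero    st = Step.accepting (sumFormula n) st
    sumFormula (suc n) (suc k) st = Step.rejecting (sumFormula n) st k

  W≈winWeight : ∀ N r → 0 < N → W R θ N r ≈ winWeight r 0 N
  W≈winWeight N r 0<N = begin
    W R θ N r
      ≈⟨ sumList-filter (words N N) distinctᵇ _ ⟩
    sumList (words N N) (λ w → if distinctᵇ w then (if winnableᵇ N r w then θ ^ index0 N w else 0#) else 0#)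
      ≈⟨ sumList-cong (words N N) (λ w → reflexive (asTerm w)) ⟩
    sumList (words N N) (term N [] r 0)
      ≈⟨ sumFormula N N r (record { distinct = _ ; bounded = [] ; m<N = 0<N ; size = ≡.refl }) ⟩
    winWeight r 0 N ∎
    where
      asTerm : ∀ w →
        (if distinctᵇ w then (if winnableᵇ N r w then θ ^ index0 N w else 0#) else 0#) ≡ term N [] r 0 w
      asTerm w rewrite avoids-[] w | winnableᵇ-accepts N r w with distinctᵇ w
      ... | true  = ≡.refl
      ... | false = ≡.refl

open import Data.Nat using (ℕ; _≤_; _∸_; _!) renaming (_*_ to _*ℕ_)
open import Data.Product using (_×_)
open import Algebra.Bundles using (CommutativeSemiring)
open import Algebra.Definitions.RawSemiring using (_^_) renaming (_×_ to _·_)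

mainTheorem1 : ∀ {c ℓ} (R : CommutativeSemiring c ℓ) (θ : CommutativeSemiring.Carrier R) →
    let open CommutativeSemiring R in
      (W R θ 1 0 ≈ 1#)
      × (∀ (r : ℕ) → 1 ≤ r → W R θ 1 r ≈ 0#)
      × (∀ (N r : ℕ) → 2 ≤ N → r ≤ N ∸ 1 →
           W R θ N r ≈ (_·_ rawSemiring (N ∸ 1) (W R θ (N ∸ 1) r)
                        + _·_ rawSemiring (r *ℕ (N ∸ 2) !) (_^_ rawSemiring θ (N ∸ 1))))
mainTheorem1 R θ = +-identityʳ 1# , (λ { (suc r) _ → +-identityʳ 0# }) , recurrence
  where
    open CommutativeSemiring R hiding (zero)
    open Summation R using (⟦_⟧; ⟦⟧*≈×)
    open WinWeights R θ using (winWeight; winWeight-lastLetter)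
    open Winnable R θ using (W≈winWeight)
    open import Relation.Binary.Reasoning.Setoid setoid

    recurrence : ∀ N r → 2 ≤ N → r ≤ N ∸ 1 →
      W R θ N r ≈ _·_ rawSemiring (N ∸ 1) (W R θ (N ∸ 1) r)
                  + _·_ rawSemiring (r *ℕ (N ∸ 2) !) (_^_ rawSemiring θ (N ∸ 1))
    recurrence (suc zero)    r (s≤s ()) _
    recurrence (suc (suc a)) r _        r≤1+a = begin
      W R θ (suc (suc a)) r
        ≈⟨ W≈winWeight (suc (suc a)) r (s≤s z≤n) ⟩
      winWeight r 0 (suc (suc a))
        ≈⟨ winWeight-lastLetter r 0 (suc a) ⟩
      ⟦ 0 ⟧ * winWeight r 0 (suc (suc a)) + ⟦ suc a ⟧ * winWeight r 0 (suc a)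
      + ⟦ loseCount r 0 (suc a) ⟧ * _^_ rawSemiring θ (suc a)
        ≈⟨ +-cong (trans (+-congʳ (zeroˡ _)) (+-identityˡ _))
                  (*-congʳ (reflexive (≡.cong ⟦_⟧ (loseCount-high r 0 a r≤1+a)))) ⟩
      ⟦ suc a ⟧ * winWeight r 0 (suc a) + ⟦ r *ℕ a ! ⟧ * _^_ rawSemiring θ (suc a)
        ≈⟨ +-cong (*-congˡ (sym (W≈winWeight (suc a) r (s≤s z≤n)))) refl ⟩
      ⟦ suc a ⟧ * W R θ (suc a) r + ⟦ r *ℕ a ! ⟧ * _^_ rawSemiring θ (suc a)
        ≈⟨ +-cong (⟦⟧*≈× (suc a) _) (⟦⟧*≈× (r *ℕ a !) _) ⟩
      _·_ rawSemiring (suc a) (W R θ (suc a) r) + _·_ rawSemiring (r *ℕ a !) (_^_ rawSemiring θ (suc a)) ∎
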